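{- For every type $\mathcal T$, $|\mathrm{Tab}(\mathcal T)|=|\mathrm{Tab}(\mathcal T^L)|=|\mathrm{Tab}(\mathcal T^C)|$.
   Context: A diagram is a finite subset $S\subset\mathbb N_{>0}^2$; $(a,b)$ is the box in row $a$ (top to bottom), column $b$. Arm $A_S(a,b)=\{(a,k)\in S:k>b\}$, leg $L_S(a,b)=\{(k,b)\in S:k\ge a\}$, hook $H_S=A_S\cup L_S$, $h_S=|H_S|$. A tableau of shape $S$ ($|S|=n$) is a bijection $t:S\to\{1,\dots,n\}$. A type of shape $S$ is a map $\theta:S\to\mathbb Z$ with $0\le\theta\le h_S-1$. The type of a tableau $T$ is $\mathfrak c\mapsto|\{\mathfrak d\in H_S(\mathfrak c):t_{\mathfrak d}<t_{\mathfrak c}\}|$; $\mathrm{Tab}(\theta)$ is the set of tableaux of shape $S$ of type $\theta$. Row $a$ is dominant in $\theta$ if it is nonempty and for every $(a,y)\in S$, $(a+1,y)\in S$ and $\theta(a,y)>\theta(a+1,y)$; then $\theta\!\downarrow_a$ is obtained by decreasing every entry of row $a$ by one and then exchanging rows $a$ and $a+1$. Column $b$ is dominant if it is nonempty and for every $(x,b)\in S$, $(x,b+1)\in S$ and $\theta(x,b)>\theta(x,b+1)$; then $\overrightarrow\theta^b$ is obtained by decreasing every entry of column $b$ by one and then exchanging columns $b$ and $b+1$. Line-exchange algorithm: delete all empty rows and renumber the remaining rows consecutively from $1$ keeping their order; set $i:=1$; if row $i$ is dominant, replace the type by its image under $\downarrow_i$ and restart with $i:=1$; otherwise, if there is no row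 below row $i$ stop, else set $i:=i+1$ and repeat. The output is $\mathcal T^L$. The column-exchange algorithm is the analogous procedure on columns (deleting/renumbering empty columns, using dominant columns and $\overrightarrow{\ }^i$), with output $\mathcal T^C$. -}

module Defs where

open import Data.Nat using (ℕ; zero; suc; _<_; _∸_; _≡ᵇ_; _<ᵇ_; _≤ᵇ_)
open import Data.Nat.Properties using () renaming (_≟_ to _≟ℕ_)
open import Data.Bool using (Bool; true; false; _∧_; _∨_; if_then_else_)
open import Data.Product using (Σ; _×_; _,_; proj₁; proj₂)
open import Data.List using (List; []; _∷_; map; length; filterᵇ; concatMap; zip; upTo; deduplicate)
open import Data.Bool.ListAction using (and)
open import Data.List.Membership.Propositional using (_∈_)
open import Data.List.Relation.Unary.All using (All)
open import Data.List.Relation.Unary.Unique.Propositional using (Unique)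
open import Relation.Binary.PropositionalEquality using (_≡_)
open import Relation.Nullary using (¬_)

-- A cell (a , b): row a (top to bottom), column b.
Cell : Set
Cell = ℕ × ℕ

-- A diagram S is given by a duplicate-free list of cells.
Diagram : Set
Diagram = List Cell

-- A type (together with its shape) is an association list cell ↦ value.
-- Its shape is the list of its cells.
TypeData : Set
TypeData = List (Cell × ℕ)

shape : TypeData → Diagram
shape θ = map proj₁ θ

-- d ∈ H_S(c) (given d ∈ S): d in the arm (same row, column > b) or the leg
-- (same column, row ≥ a; includes c itself).
inHook : Cell → Cell → Bool
inHook (a , b) (x , y) = ((x ≡ᵇ a) ∧ (b <ᵇ y)) ∨ ((y ≡ᵇ b) ∧ (a ≤ᵇ x))

hook : Diagram → Cell → List Cell
hook S c = filterᵇ (inHook c) S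

hookLen : Diagram → Cell → ℕ
hookLen S c = length (hook S c)

PosCell : Cell → Set
PosCell (a , b) = (0 < a) × (0 < b)

IsType : TypeData → Set
IsType θ = Unique (shape θ)
         × All PosCell (shape θ)
         × All (λ cv → proj₂ cv < hookLen (shape θ) (proj₁ cv)) θ

-- value at a cell of an association list (0 if absent; only used on present cells)
valAt : List (Cell × ℕ) → Cell → ℕ
valAt [] c = 0
valAt (((x , y) , v) ∷ t) (a , b) =
  if (x ≡ᵇ a) ∧ (y ≡ᵇ b) then v else valAt t (a , b)

insertAll : {A : Set} → A → List A → List (List A)
insertAll x [] = (x ∷ []) ∷ []
insertAll x (y ∷ ys) = (x ∷ y ∷ ys) ∷ map (y ∷_) (insertAll x ys)

perms : {A : Set} → List A → List (List A)
perms [] = [] ∷ []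
perms (x ∷ xs) = concatMap (insertAll x) (perms xs)

-- Tableaux of shape S: bijections S → {1,…,n}, n = |S|, represented as the
-- list of pairs (cell , label); one for each permutation of the labels 1..n.
tableaux : Diagram → List (List (Cell × ℕ))
tableaux S = map (zip S) (perms (map suc (upTo (length S))))

typeOfAt : Diagram → List (Cell × ℕ) → Cell → ℕ
typeOfAt S t c = length (filterᵇ (λ d → valAt t d <ᵇ valAt t c) (hook S c))

hasType : TypeData → List (Cell × ℕ) → Bool
hasType θ t = and (map (λ cv → typeOfAt (shape θ) t (proj₁ cv) ≡ᵇ proj₂ cv) θ)

numTab : TypeData → ℕ
numTab θ = length (filterᵇ (hasType θ) (tableaux (shape θ)))

occRows : TypeData → List ℕ
occRows θ = deduplicate _≟ℕ_ (map proj₁ (shape θ))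

-- delete empty rows and renumber the remaining ones 1,2,… keeping order
renumberRows : TypeData → TypeData
renumberRows θ = map (λ { ((a , b) , v) → ((suc (length (filterᵇ (_<ᵇ a) (occRows θ))) , b) , v) }) θ

RowDominant : TypeData → ℕ → Set
RowDominant θ a =
  (Σ ℕ λ y → Σ ℕ λ v → ((a , y) , v) ∈ θ)
  × (∀ y v → ((a , y) , v) ∈ θ → Σ ℕ λ w → (((suc a , y) , w) ∈ θ) × (w < v))

rowDown : ℕ → TypeData → TypeData
rowDown a = map f
  where
  f : Cell × ℕ → Cell × ℕ
  f ((x , y) , v) =
    if x ≡ᵇ a then ((suc a , y) , v ∸ 1)
    else if x ≡ᵇ suc a then ((a , y) , v)
    else ((x , y) , v)

-- Run of the loop (rows already renumbered): scanning i = 1,2,… and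
-- restarting at 1 after each exchange amounts to always exchanging at the
-- smallest dominant row, and stopping when no row is dominant.
data LineRun : TypeData → TypeData → Set where
  stop : ∀ {θ} → (∀ i → ¬ RowDominant θ i) → LineRun θ θ
  step : ∀ {θ θ'} i → RowDominant θ i → (∀ j → j < i → ¬ RowDominant θ j)
       → LineRun (rowDown i θ) θ' → LineRun θ θ'

LineExchange : TypeData → TypeData → Set
LineExchange θ θL = LineRun (renumberRows θ) θL

occCols : TypeData → List ℕ
occCols θ = deduplicate _≟ℕ_ (map proj₂ (shape θ))

renumberCols : TypeData → TypeData
renumberCols θ = map (λ { ((a , b) , v) → ((a , suc (length (filterᵇ (_<ᵇ b) (occCols θ)))) , v) }) θ

ColDominant : TypeData → ℕ → Set
ColDominant θ b =
  (Σ ℕ λ x → Σ ℕ λ v → ((x , b) , v) ∈ θ)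
  × (∀ x v → ((x , b) , v) ∈ θ → Σ ℕ λ w → (((x , suc b) , w) ∈ θ) × (w < v))

colRight : ℕ → TypeData → TypeData
colRight b = map f
  where
  f : Cell × ℕ → Cell × ℕ
  f ((x , y) , v) =
    if y ≡ᵇ b then ((x , suc b) , v ∸ 1)
    else if y ≡ᵇ suc b then ((x , b) , v)
    else ((x , y) , v)

data ColRun : TypeData → TypeData → Set where
  stop : ∀ {θ} → (∀ i → ¬ ColDominant θ i) → ColRun θ θ
  step : ∀ {θ θ'} i → ColDominant θ i → (∀ j → j < i → ¬ ColDominant θ j)
       → ColRun (colRight i θ) θ' → ColRun θ θ'

ColumnExchange : TypeData → TypeData → Set
ColumnExchange θ θC = ColRun (renumberCols θ) θC

-- A dominant-row exchange θ ↦ θ↓ₐ acts on tableaux by keeping every label and interchanging the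
-- cells of rows a and a+1 column by column.  In a tableau of type θ, dominance of row a forces
-- every cell of row a to carry a larger label than the cell below it: at the rightmost violation,
-- pushing the smaller arm cells one row down injects the smaller hook cells of (a,y) into those of
-- (a+1,y), so θ(a,y) ≤ θ(a+1,y), contradicting dominance.  Once the labels descend, exchanging the
-- rows removes exactly one smaller cell from each hook in row a and changes no other hook count,
-- so the moved tableau has type θ↓ₐ; the same argument run on θ↓ₐ inverts the map.  Deleting empty
-- rows relabels rows monotonically and so preserves hooks.  Columns reduce to rows by
-- transposition, which preserves hooks as well.

module Submission where

open import Level using (0ℓ)
open import Defs
open import Data.Bool using (Bool; true; false; _∧_; T; if_then_else_)
open import Data.Nat using (ℕ; zero; suc; _+_; _∸_; _≤_; _<_; z≤n; s≤s; s≤s⁻¹; _≡ᵇ_; _<ᵇ_)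
open import Data.Nat.Properties
open import Data.Nat.ListAction using (sum)
open import Data.Nat.Induction using (<-wellFounded)
open import Data.Product using (Σ; _×_; _,_; proj₁; proj₂; uncurry; swap; map₁)
open import Data.Sum using (_⊎_; inj₁; inj₂; [_,_]′)
open import Data.List using (List; []; _∷_; _++_; map; length; filter; filterᵇ; zip; upTo; deduplicate)
open import Data.List.Properties using (length-map; length-++; length-upTo; map-∘; map-cong)
open import Data.List.Extrema.Nat using (max; xs≤max)
open import Data.List.Membership.Propositional using (_∈_; find; lose)
open import Data.List.Membership.Propositional.Properties
  using (∈-filter⁺; ∈-filter⁻; ∈-map⁺; ∈-map⁻; ∈-∃++; ∈-++⁻; ∈-++⁺ˡ; ∈-++⁺ʳ; ∈-concatMap⁻; ∈-deduplicate⁺)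
open import Data.List.Relation.Unary.Any using (Any; here; there; any?)
open import Data.List.Relation.Unary.All using (All; all?)
import Data.List.Relation.Unary.All as All
open import Data.List.Relation.Unary.All.Properties using (all⁺; all⁻; map⁺; map⁻)
open import Data.List.Relation.Unary.AllPairs using ([]; _∷_)
open import Data.List.Relation.Unary.Unique.Propositional using (Unique)
import Data.List.Relation.Unary.Unique.Propositional.Properties as Unique
open import Data.List.Relation.Binary.Permutation.Propositional
  using (_↭_; ↭-refl; ↭-prep; ↭-swap; ↭-trans; ↭-sym; ↭⇒↭ₛ)
open import Data.List.Relation.Binary.Permutation.Propositional.Properties using (↭-length)
import Data.List.Relation.Binary.Permutation.Setoid.Properties as Setoid↭
open import Function using (_⇔_; mk⇔; Equivalence; _∘_)
open import Function.Properties.Equivalence using () renaming (trans to ⇔-trans; sym to ⇔-sym)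
import Induction.WellFounded as WF
import Relation.Binary.Construct.On as On
open import Relation.Nullary using (¬_; Dec; yes; no; does; _×-dec_; _⊎-dec_; _→-dec_; contradiction)
open import Relation.Nullary.Decidable using (map′; T?; dec-true; dec-false)
open import Relation.Unary using (Pred; Decidable)
open import Relation.Binary using (DecidableEquality)
open import Relation.Binary.PropositionalEquality

count : {A : Set} {P : Pred A 0ℓ} → Decidable P → List A → ℕ
count P? xs = length (filter P? xs)

module _ {A : Set} where

  Unique-⊆⇒length-≤ : (ys zs : List A) → Unique ys → (∀ {x} → x ∈ ys → x ∈ zs) → length ys ≤ length zs
  Unique-⊆⇒length-≤ [] zs _ _ = z≤n
  Unique-⊆⇒length-≤ (y ∷ ys) zs (y∉ys ∷ u) ys⊆zs with ∈-∃++ (ys⊆zs (here refl))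
  ... | l , r , refl = begin
      suc (length ys)           ≤⟨ s≤s (Unique-⊆⇒length-≤ ys (l ++ r) u ys⊆l++r) ⟩
      suc (length (l ++ r))     ≡⟨ cong suc (length-++ l) ⟩
      suc (length l + length r) ≡⟨ +-suc (length l) (length r) ⟨
      length l + length (y ∷ r) ≡⟨ length-++ l ⟨
      length (l ++ y ∷ r)       ∎
    where
    open ≤-Reasoning
    ys⊆l++r : ∀ {x} → x ∈ ys → x ∈ l ++ r
    ys⊆l++r {x} x∈ys with ∈-++⁻ l (ys⊆zs (there x∈ys))
    ... | inj₁ x∈l = ∈-++⁺ˡ x∈l
    ... | inj₂ (here refl) = contradiction refl (All.lookup y∉ys x∈ys)
    ... | inj₂ (there x∈r) = ∈-++⁺ʳ l x∈r

  Unique-map-injectiveOn : (f : A → A) (xs : List A) → Unique xs →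
    (∀ {x y} → x ∈ xs → y ∈ xs → f x ≡ f y → x ≡ y) → Unique (map f xs)
  Unique-map-injectiveOn f [] _ _ = []
  Unique-map-injectiveOn f (x ∷ xs) (x∉xs ∷ u) inj =
    All.tabulate (λ fy∈ fx≡fy → let y , y∈xs , fy≡ = ∈-map⁻ f fy∈ in
      All.lookup x∉xs y∈xs (inj (here refl) (there y∈xs) (trans fx≡fy fy≡)))
    ∷ Unique-map-injectiveOn f xs u (λ x∈ y∈ → inj (there x∈) (there y∈))

module _ {A : Set} {P Q : Pred A 0ℓ} {P? : Decidable P} {Q? : Decidable Q} where

  count-mono : (xs : List A) → (∀ {x} → x ∈ xs → P x → Q x) → count P? xs ≤ count Q? xs
  count-mono [] _ = z≤n
  count-mono (x ∷ xs) P⇒Q with P? x | Q? x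
  ... | yes _  | yes _  = s≤s (count-mono xs (λ x∈ → P⇒Q (there x∈)))
  ... | yes px | no ¬qx = contradiction (P⇒Q (here refl) px) ¬qx
  ... | no _   | yes _  = m≤n⇒m≤1+n (count-mono xs (λ x∈ → P⇒Q (there x∈)))
  ... | no _   | no _   = count-mono xs (λ x∈ → P⇒Q (there x∈))

module _ {A : Set} {P Q : Pred A 0ℓ} {P? : Decidable P} {Q? : Decidable Q} where

  count-cong : (xs : List A) → (∀ {x} → x ∈ xs → P x → Q x) → (∀ {x} → x ∈ xs → Q x → P x) →
    count P? xs ≡ count Q? xs
  count-cong xs P⇒Q Q⇒P = ≤-antisym (count-mono xs P⇒Q) (count-mono xs Q⇒P)

  count-cong-except : (xs : List A) → ∀ {z} →
    (∀ {x} → x ∈ xs → x ≢ z → P x → Q x) → (∀ {x} → x ∈ xs → x ≢ z → Q x → P x) →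
    ¬ P z → ¬ Q z → count P? xs ≡ count Q? xs
  count-cong-except xs P⇒Q Q⇒P ¬pz ¬qz =
    count-cong xs (λ x∈ px → P⇒Q x∈ (λ { refl → ¬pz px }) px)
                  (λ x∈ qx → Q⇒P x∈ (λ { refl → ¬qz qx }) qx)

  count-except : (xs : List A) → Unique xs → ∀ {z} → z ∈ xs →
    (∀ {x} → x ∈ xs → x ≢ z → P x → Q x) → (∀ {x} → x ∈ xs → x ≢ z → Q x → P x) →
    P z → ¬ Q z → count P? xs ≡ suc (count Q? xs)
  count-except (x ∷ xs) (x∉xs ∷ u) (here refl) P⇒Q Q⇒P pz ¬qz with P? x | Q? x
  ... | no ¬pz | _      = contradiction pz ¬pz
  ... | yes _  | yes qz = contradiction qz ¬qz
  ... | yes _  | no _   = cong suc (count-cong xs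
          (λ y∈ → P⇒Q (there y∈) (λ y≡x → All.lookup x∉xs y∈ (sym y≡x)))
          (λ y∈ → Q⇒P (there y∈) (λ y≡x → All.lookup x∉xs y∈ (sym y≡x))))
  count-except (x ∷ xs) (x∉xs ∷ u) (there z∈xs) P⇒Q Q⇒P pz ¬qz
    with P? x | Q? x | count-except xs u z∈xs (λ y∈ → P⇒Q (there y∈)) (λ y∈ → Q⇒P (there y∈)) pz ¬qz
  ... | yes _  | yes _  | ih = cong suc ih
  ... | no _   | no _   | ih = ih
  ... | yes px | no ¬qx | _  = contradiction (P⇒Q (here refl) (All.lookup x∉xs z∈xs) px) ¬qx
  ... | no ¬px | yes qx | _  = contradiction (Q⇒P (here refl) (All.lookup x∉xs z∈xs) qx) ¬px

  count-≤-injection : (xs : List A) → Unique xs → (f : A → A) →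
    (∀ {x y} → x ∈ xs → y ∈ xs → P x → P y → f x ≡ f y → x ≡ y) →
    (∀ {x} → x ∈ xs → P x → f x ∈ xs × Q (f x)) → count P? xs ≤ count Q? xs
  count-≤-injection xs u f inj maps = begin
      count P? xs                   ≡⟨ length-map f (filter P? xs) ⟨
      length (map f (filter P? xs)) ≤⟨ Unique-⊆⇒length-≤ _ _ unique image⊆ ⟩
      count Q? xs                   ∎
    where
    open ≤-Reasoning
    unique : Unique (map f (filter P? xs))
    unique = Unique-map-injectiveOn f _ (Unique.filter⁺ P? u) λ x∈ y∈ →
      let x∈xs , px = ∈-filter⁻ P? x∈ ; y∈xs , py = ∈-filter⁻ P? y∈ in inj x∈xs y∈xs px py
    image⊆ : ∀ {y} → y ∈ map f (filter P? xs) → y ∈ filter Q? xs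
    image⊆ y∈ with ∈-map⁻ f y∈
    ... | x , x∈ , refl =
      let x∈xs , px = ∈-filter⁻ P? x∈ ; fx∈xs , qfx = maps x∈xs px in ∈-filter⁺ Q? fx∈xs qfx

  count-< : (xs : List A) → (∀ {x} → x ∈ xs → P x → Q x) →
    ∀ {z} → z ∈ xs → ¬ P z → Q z → count P? xs < count Q? xs
  count-< (x ∷ xs) P⇒Q (here refl) ¬pz qz with P? x | Q? x
  ... | yes pz | _ = contradiction pz ¬pz
  ... | no _ | no ¬qz = contradiction qz ¬qz
  ... | no _ | yes _ = s≤s (count-mono xs (λ y∈ → P⇒Q (there y∈)))
  count-< (x ∷ xs) P⇒Q (there z∈) ¬pz qz with P? x | Q? x
  ... | yes _ | yes _ = s≤s (count-< xs (λ y∈ → P⇒Q (there y∈)) z∈ ¬pz qz)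
  ... | yes px | no ¬qx = contradiction (P⇒Q (here refl) px) ¬qx
  ... | no _ | yes _ = m≤n⇒m≤1+n (count-< xs (λ y∈ → P⇒Q (there y∈)) z∈ ¬pz qz)
  ... | no _ | no _ = count-< xs (λ y∈ → P⇒Q (there y∈)) z∈ ¬pz qz

count-map : {A B : Set} {P : Pred B 0ℓ} (P? : Decidable P) (f : A → B) →
  ∀ xs → count P? (map f xs) ≡ count (P? ∘ f) xs
count-map P? f [] = refl
count-map P? f (x ∷ xs) with does (P? (f x))
... | true = cong suc (count-map P? f xs)
... | false = count-map P? f xs

InHook : Cell → Cell → Set
InHook (a , b) (x , y) = (x ≡ a × b < y) ⊎ (y ≡ b × a ≤ x)

-- does (inHook? c d) is definitionally inHook c d.
inHook? : (c d : Cell) → Dec (InHook c d)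
inHook? (a , b) (x , y) = ((x ≟ a) ×-dec (b <? y)) ⊎-dec ((y ≟ b) ×-dec (a ≤? x))

Smaller : (Cell → ℕ) → Cell → Cell → Set
Smaller lab c d = InHook c d × lab d < lab c

smaller? : (lab : Cell → ℕ) (c : Cell) → Decidable (Smaller lab c)
smaller? lab c d = inHook? c d ×-dec (lab d <? lab c)

typeAt : Diagram → (Cell → ℕ) → Cell → ℕ
typeAt S lab c = count (smaller? lab c) S

module _ {A : Set} where

  filter≡filterᵇ : {P : Pred A 0ℓ} (P? : Decidable P) (p : A → Bool) →
    (∀ x → does (P? x) ≡ p x) → ∀ xs → filter P? xs ≡ filterᵇ p xs
  filter≡filterᵇ P? p h [] = refl
  filter≡filterᵇ P? p h (x ∷ xs) with does (P? x) | p x | h x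
  ... | true  | .true  | refl = cong (x ∷_) (filter≡filterᵇ P? p h xs)
  ... | false | .false | refl = filter≡filterᵇ P? p h xs

  filterᵇ-filterᵇ : (p q : A → Bool) → ∀ xs → filterᵇ q (filterᵇ p xs) ≡ filterᵇ (λ x → p x ∧ q x) xs
  filterᵇ-filterᵇ p q [] = refl
  filterᵇ-filterᵇ p q (x ∷ xs) with p x
  ... | false = filterᵇ-filterᵇ p q xs
  ... | true with q x
  ...   | false = filterᵇ-filterᵇ p q xs
  ...   | true  = cong (x ∷_) (filterᵇ-filterᵇ p q xs)

typeOfAt≡typeAt : ∀ S t c → typeOfAt S t c ≡ typeAt S (valAt t) c
typeOfAt≡typeAt S t c = cong length (trans
  (filterᵇ-filterᵇ (inHook c) (λ d → valAt t d <ᵇ valAt t c) S)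
  (sym (filter≡filterᵇ (smaller? (valAt t) c) _ (λ _ → refl) S)))

-- Tableaux as labellings by permutations

insertAll-↭ : ∀ {A : Set} (x : A) ys {zs} → zs ∈ insertAll x ys → zs ↭ x ∷ ys
insertAll-↭ x [] (here refl) = ↭-refl
insertAll-↭ x (y ∷ ys) (here refl) = ↭-refl
insertAll-↭ x (y ∷ ys) (there zs∈) with ∈-map⁻ (y ∷_) zs∈
... | zs , zs∈′ , refl = ↭-trans (↭-prep y (insertAll-↭ x ys zs∈′)) (↭-swap y x ↭-refl)

perms-↭ : ∀ {A : Set} (xs : List A) {p} → p ∈ perms xs → p ↭ xs
perms-↭ [] (here refl) = ↭-refl
perms-↭ (x ∷ xs) p∈ with find (∈-concatMap⁻ (insertAll x) {xs = perms xs} p∈)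
... | q , q∈ , p∈′ = ↭-trans (insertAll-↭ x q p∈′) (↭-prep x (perms-↭ xs q∈))

Unique-perms : ∀ {A : Set} {xs : List A} {p} → Unique xs → p ∈ perms xs → Unique p
Unique-perms {A} {xs} u p∈ = Setoid↭.Unique-resp-↭ (setoid A) (↭⇒↭ₛ (↭-sym (perms-↭ xs p∈))) u

-- Unlike Data.Product.Properties.≡-dec, this decision computes to the boolean test in valAt.
_≟ᶜ_ : DecidableEquality Cell
(x , y) ≟ᶜ (a , b) = map′ (uncurry (cong₂ _,_)) (λ { refl → refl , refl }) ((x ≟ a) ×-dec (y ≟ b))

valAt-here : ∀ c v t → valAt ((c , v) ∷ t) c ≡ v
valAt-here c v t = cong (if_then v else valAt t c) (dec-true (c ≟ᶜ c) refl)

valAt-there : ∀ {d c} v t → d ≢ c → valAt ((d , v) ∷ t) c ≡ valAt t c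
valAt-there {d} {c} v t d≢c = cong (if_then v else valAt t c) (dec-false (d ≟ᶜ c) d≢c)

valAt-zip-∈ : ∀ S p → length S ≤ length p → Unique S → ∀ {c} → c ∈ S → valAt (zip S p) c ∈ p
valAt-zip-∈ (d ∷ S) (q ∷ p) _ _ (here refl) = subst (_∈ q ∷ p) (sym (valAt-here d q (zip S p))) (here refl)
valAt-zip-∈ (d ∷ S) (q ∷ p) (s≤s len) (d∉S ∷ u) {c} (there c∈S) =
  subst (_∈ q ∷ p) (sym (valAt-there {d} {c} q (zip S p) (All.lookup d∉S c∈S)))
    (there (valAt-zip-∈ S p len u c∈S))

labelling-injective : ∀ S p → length S ≤ length p → Unique S → Unique p →
  ∀ {c d} → c ∈ S → d ∈ S → valAt (zip S p) c ≡ valAt (zip S p) d → c ≡ d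
labelling-injective (e ∷ S) (q ∷ p) (s≤s len) (e∉S ∷ uS) (q∉p ∷ up) = λ
  { (here refl) (here refl) _ → refl
  ; (here refl) (there d∈S) eq → contradiction (trans eq (tail d∈S)) (head-fresh d∈S)
  ; (there c∈S) (here refl) eq → contradiction (trans (sym eq) (tail c∈S)) (head-fresh c∈S)
  ; (there c∈S) (there d∈S) eq →
      labelling-injective S p len uS up c∈S d∈S (trans (sym (tail c∈S)) (trans eq (tail d∈S)))
  }
  where
  tail : ∀ {c} → c ∈ S → valAt (zip (e ∷ S) (q ∷ p)) c ≡ valAt (zip S p) c
  tail {c} c∈S = valAt-there {e} {c} q (zip S p) (All.lookup e∉S c∈S)
  head-fresh : ∀ {c} → c ∈ S → valAt (zip (e ∷ S) (q ∷ p)) e ≢ valAt (zip S p) c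
  head-fresh c∈S eq = All.lookup q∉p (valAt-zip-∈ S p len uS c∈S) (trans (sym (valAt-here e q (zip S p))) eq)

valAt-relocate : (g : Cell → Cell) (S : Diagram) (p : List ℕ) →
  (∀ {c d} → c ∈ S → d ∈ S → g c ≡ g d → c ≡ d) →
  ∀ {c} → c ∈ S → valAt (zip (map g S) p) (g c) ≡ valAt (zip S p) c
valAt-relocate g (d ∷ S) [] _ _ = refl
valAt-relocate g (d ∷ S) (q ∷ p) g-inj {c} c∈ with d ≟ᶜ c
... | yes refl = trans (valAt-here (g d) q (zip (map g S) p)) (sym (valAt-here d q (zip S p)))
... | no d≢c = begin
    valAt ((g d , q) ∷ zip (map g S) p) (g c) ≡⟨ valAt-there q (zip (map g S) p) (d≢c ∘ g-inj (here refl) c∈) ⟩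
    valAt (zip (map g S) p) (g c)             ≡⟨ valAt-relocate g S p g-inj′ (c∈S c∈) ⟩
    valAt (zip S p) c                         ≡⟨ valAt-there q (zip S p) d≢c ⟨
    valAt ((d , q) ∷ zip S p) c               ∎
  where
  open ≡-Reasoning
  g-inj′ : ∀ {c d} → c ∈ S → d ∈ S → g c ≡ g d → c ≡ d
  g-inj′ c∈ d∈ = g-inj (there c∈) (there d∈)
  c∈S : c ∈ d ∷ S → c ∈ S
  c∈S (here refl) = contradiction refl d≢c
  c∈S (there c∈S) = c∈S

labels : ℕ → List ℕ
labels n = map suc (upTo n)

perms-labelling-injective : ∀ {S p} → Unique S → p ∈ perms (labels (length S)) →
  ∀ {c d} → c ∈ S → d ∈ S → valAt (zip S p) c ≡ valAt (zip S p) d → c ≡ d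
perms-labelling-injective {S} {p} uS p∈ =
  labelling-injective S p (≤-reflexive (sym length-p)) uS (Unique-perms (Unique.map⁺ suc-injective (Unique.upTo⁺ n)) p∈)
  where
  n : ℕ
  n = length S
  length-p : length p ≡ n
  length-p = begin
    length p          ≡⟨ ↭-length (perms-↭ (labels n) p∈) ⟩
    length (labels n) ≡⟨ length-map suc (upTo n) ⟩
    length (upTo n)   ≡⟨ length-upTo n ⟩
    n                 ∎
    where open ≡-Reasoning

HasType : TypeData → List ℕ → Set
HasType θ p = All (λ cv → typeAt (shape θ) (valAt (zip (shape θ) p)) (proj₁ cv) ≡ proj₂ cv) θ

hasType⇔HasType : ∀ θ p → T (hasType θ (zip (shape θ) p)) ⇔ HasType θ p
hasType⇔HasType θ p = mk⇔
  (λ t → All.map (λ {cv} e → trans (sym (typeOfAt≡typeAt S t′ (proj₁ cv))) (≡ᵇ⇒≡ _ _ e)) (all⁺ check θ t))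
  (λ h → all⁻ check (All.map (λ {cv} e → ≡⇒≡ᵇ _ _ (trans (typeOfAt≡typeAt S t′ (proj₁ cv)) e)) h))
  where
  S : Diagram
  S = shape θ
  t′ : List (Cell × ℕ)
  t′ = zip S p
  check : Cell × ℕ → Bool
  check cv = typeOfAt S t′ (proj₁ cv) ≡ᵇ proj₂ cv

length-filterᵇ-map : {A B : Set} (h : B → Bool) (f : A → B) → ∀ xs →
  length (filterᵇ h (map f xs)) ≡ length (filterᵇ (h ∘ f) xs)
length-filterᵇ-map h f [] = refl
length-filterᵇ-map h f (x ∷ xs) with h (f x)
... | true = cong suc (length-filterᵇ-map h f xs)
... | false = length-filterᵇ-map h f xs

numTab≡count : ∀ θ → numTab θ ≡ count (λ p → T? (hasType θ (zip (shape θ) p))) (perms (labels (length (shape θ))))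
numTab≡count θ = trans (length-filterᵇ-map (hasType θ) (zip (shape θ)) P)
  (cong length (sym (filter≡filterᵇ (λ p → T? (hasType θ (zip (shape θ) p))) _ (λ _ → refl) P)))
  where
  P : List (List ℕ)
  P = perms (labels (length (shape θ)))

numTab-cong : ∀ {θ θ′} → length (shape θ) ≡ length (shape θ′) →
  (∀ {p} → p ∈ perms (labels (length (shape θ))) → HasType θ p ⇔ HasType θ′ p) → numTab θ ≡ numTab θ′
numTab-cong {θ} {θ′} length-eq hasType-eq = begin
  numTab θ                                         ≡⟨ numTab≡count θ ⟩
  count tab? (perms (labels (length (shape θ))))   ≡⟨ count-cong _ (via ∘ Equivalence.to ∘ hasType-eq)
                                                                   (via ∘ Equivalence.from ∘ hasType-eq) ⟩
  count tab?′ (perms (labels (length (shape θ))))  ≡⟨ cong (λ n → count tab?′ (perms (labels n))) length-eq ⟩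
  count tab?′ (perms (labels (length (shape θ′)))) ≡⟨ numTab≡count θ′ ⟨
  numTab θ′                                        ∎
  where
  open ≡-Reasoning
  tab? : ∀ p → Dec (T (hasType θ (zip (shape θ) p)))
  tab? p = T? (hasType θ (zip (shape θ) p))
  tab?′ : ∀ p → Dec (T (hasType θ′ (zip (shape θ′) p)))
  tab?′ p = T? (hasType θ′ (zip (shape θ′) p))
  via : ∀ {θ₁ θ₂ p} → (HasType θ₁ p → HasType θ₂ p) →
    T (hasType θ₁ (zip (shape θ₁) p)) → T (hasType θ₂ (zip (shape θ₂) p))
  via {θ₁} {θ₂} {p} f t = Equivalence.from (hasType⇔HasType θ₂ p) (f (Equivalence.to (hasType⇔HasType θ₁ p) t))

movedTypeAt : (Cell → Cell) → Diagram → (Cell → ℕ) → Cell → ℕ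
movedTypeAt g S lab c = count (λ d → inHook? (g c) (g d) ×-dec (lab d <? lab c)) S

-- A tableau of shape map g S is read as the labelling of S that gives d the label of g d, so
-- numTab of a relocated type counts the same permutations of labels.
module Relocation (θ : TypeData) (G : Cell × ℕ → Cell × ℕ) (g : Cell → Cell)
  (G-cell : ∀ e → proj₁ (G e) ≡ g (proj₁ e))
  (g-injective : ∀ {c d} → c ∈ shape θ → d ∈ shape θ → g c ≡ g d → c ≡ d) where

  S : Diagram
  S = shape θ

  shape-map : shape (map G θ) ≡ map g S
  shape-map = trans (sym (map-∘ θ)) (trans (map-cong G-cell θ) (map-∘ θ))

  Unique-shape-map : Unique S → Unique (shape (map G θ))
  Unique-shape-map u = subst Unique (sym shape-map) (Unique-map-injectiveOn g S u g-injective)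

  typeAt-map : ∀ p {c} → c ∈ S →
    typeAt (map g S) (valAt (zip (map g S) p)) (g c) ≡ movedTypeAt g S (valAt (zip S p)) c
  typeAt-map p {c} c∈S = trans (count-map (smaller? lab′ (g c)) g S) (count-cong S
      (λ d∈S (d∈H , lt) → d∈H , subst₂ _<_ (moved d∈S) (moved c∈S) lt)
      (λ d∈S (d∈H , lt) → d∈H , subst₂ _<_ (sym (moved d∈S)) (sym (moved c∈S)) lt))
    where
    lab′ : Cell → ℕ
    lab′ = valAt (zip (map g S) p)
    moved : ∀ {d} → d ∈ S → lab′ (g d) ≡ valAt (zip S p) d
    moved = valAt-relocate g S p g-injective

  HasType-map : ∀ p → HasType (map G θ) p ⇔
    All (λ cv → movedTypeAt g S (valAt (zip S p)) (proj₁ cv) ≡ proj₂ (G cv)) θ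
  HasType-map p = mk⇔
    (λ h → All.tabulate λ cv∈ → trans (sym (type-eq cv∈)) (All.lookup (map⁻ h) cv∈))
    (λ h → map⁺ (All.tabulate λ cv∈ → trans (type-eq cv∈) (All.lookup h cv∈)))
    where
    type-eq : ∀ {cv} → cv ∈ θ → typeAt (shape (map G θ)) (valAt (zip (shape (map G θ)) p)) (proj₁ (G cv))
                                ≡ movedTypeAt g S (valAt (zip S p)) (proj₁ cv)
    type-eq {cv} cv∈ rewrite shape-map | G-cell cv = typeAt-map p (∈-map⁺ proj₁ cv∈)

  numTab-map : (∀ {p} → p ∈ perms (labels (length S)) → HasType θ p ⇔
                 All (λ cv → movedTypeAt g S (valAt (zip S p)) (proj₁ cv) ≡ proj₂ (G cv)) θ) →
    numTab θ ≡ numTab (map G θ)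
  numTab-map moved-type = numTab-cong (sym (trans (cong length shape-map) (length-map g S)))
    (λ p∈ → ⇔-trans (moved-type p∈) (⇔-sym (HasType-map _)))

  numTab-map-preservingHooks : (∀ {c d} → c ∈ S → d ∈ S → InHook (g c) (g d) ⇔ InHook c d) →
    (∀ e → proj₂ (G e) ≡ proj₂ e) → numTab θ ≡ numTab (map G θ)
  numTab-map-preservingHooks hook-eq G-value = numTab-map λ {p} _ → mk⇔
    (λ h → All.tabulate λ {cv} cv∈ →
      trans (moved≡type p (∈-map⁺ proj₁ cv∈)) (trans (All.lookup h cv∈) (sym (G-value cv))))
    (λ h → All.tabulate λ {cv} cv∈ →
      trans (sym (moved≡type p (∈-map⁺ proj₁ cv∈))) (trans (All.lookup h cv∈) (G-value cv)))
    where
    moved≡type : ∀ p {c} → c ∈ S → movedTypeAt g S (valAt (zip S p)) c ≡ typeAt S (valAt (zip S p)) c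
    moved≡type p c∈S = count-cong S
      (λ d∈S (d∈H , lt) → Equivalence.to (hook-eq c∈S d∈S) d∈H , lt)
      (λ d∈S (d∈H , lt) → Equivalence.from (hook-eq c∈S d∈S) d∈H , lt)

-- Exchanging two adjacent rows

data RowPosition (a : ℕ) : ℕ → Set where
  atUpper : RowPosition a a
  atLower : RowPosition a (suc a)
  apart : ∀ {x} → x ≢ a → x ≢ suc a → RowPosition a x

rowPosition : ∀ a x → RowPosition a x
rowPosition a x with x ≟ a | x ≟ suc a
... | yes refl | _ = atUpper
... | no _ | yes refl = atLower
... | no x≢a | no x≢1+a = apart x≢a x≢1+a

≡ᵇ-refl : ∀ a → (a ≡ᵇ a) ≡ true
≡ᵇ-refl a = dec-true (a ≟ a) refl

≡ᵇ-≢ : ∀ {x a} → x ≢ a → (x ≡ᵇ a) ≡ false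
≡ᵇ-≢ {x} {a} = dec-false (x ≟ a)

swapAdjacent : ℕ → ℕ → ℕ
swapAdjacent a x = if x ≡ᵇ a then suc a else if x ≡ᵇ suc a then a else x

swapRows : ℕ → Cell → Cell
swapRows a (x , y) = (swapAdjacent a x , y)

-- rowDown a is definitionally map (moveRowDown a).
moveRowDown : ℕ → Cell × ℕ → Cell × ℕ
moveRowDown a ((x , y) , v) =
  if x ≡ᵇ a then ((suc a , y) , v ∸ 1)
  else if x ≡ᵇ suc a then ((a , y) , v)
  else ((x , y) , v)

module _ (a : ℕ) where

  swapAdjacent-upper : swapAdjacent a a ≡ suc a
  swapAdjacent-upper rewrite ≡ᵇ-refl a = refl

  swapAdjacent-lower : swapAdjacent a (suc a) ≡ a
  swapAdjacent-lower rewrite ≡ᵇ-≢ (1+n≢n {a}) | ≡ᵇ-refl (suc a) = refl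

  swapAdjacent-apart : ∀ {x} → x ≢ a → x ≢ suc a → swapAdjacent a x ≡ x
  swapAdjacent-apart x≢a x≢1+a rewrite ≡ᵇ-≢ x≢a | ≡ᵇ-≢ x≢1+a = refl

  moveRowDown-upper : ∀ y v → moveRowDown a ((a , y) , v) ≡ ((suc a , y) , v ∸ 1)
  moveRowDown-upper y v rewrite ≡ᵇ-refl a = refl

  moveRowDown-lower : ∀ y v → moveRowDown a ((suc a , y) , v) ≡ ((a , y) , v)
  moveRowDown-lower y v rewrite ≡ᵇ-≢ (1+n≢n {a}) | ≡ᵇ-refl (suc a) = refl

  moveRowDown-apart : ∀ {x} y v → x ≢ a → x ≢ suc a → moveRowDown a ((x , y) , v) ≡ ((x , y) , v)
  moveRowDown-apart y v x≢a x≢1+a rewrite ≡ᵇ-≢ x≢a | ≡ᵇ-≢ x≢1+a = refl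

  moveRowDown-cell : ∀ e → proj₁ (moveRowDown a e) ≡ swapRows a (proj₁ e)
  moveRowDown-cell ((x , y) , v) with rowPosition a x
  ... | atUpper rewrite moveRowDown-upper y v | swapAdjacent-upper = refl
  ... | atLower rewrite moveRowDown-lower y v | swapAdjacent-lower = refl
  ... | apart x≢a x≢1+a rewrite moveRowDown-apart y v x≢a x≢1+a | swapAdjacent-apart x≢a x≢1+a = refl

  swapAdjacent-involutive : ∀ x → swapAdjacent a (swapAdjacent a x) ≡ x
  swapAdjacent-involutive x with rowPosition a x
  ... | atUpper rewrite swapAdjacent-upper = swapAdjacent-lower
  ... | atLower rewrite swapAdjacent-lower = swapAdjacent-upper
  ... | apart x≢a x≢1+a rewrite swapAdjacent-apart x≢a x≢1+a = swapAdjacent-apart x≢a x≢1+a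

  swapAdjacent-injective : ∀ {x u} → swapAdjacent a x ≡ swapAdjacent a u → x ≡ u
  swapAdjacent-injective {x} {u} eq =
    trans (sym (swapAdjacent-involutive x)) (trans (cong (swapAdjacent a) eq) (swapAdjacent-involutive u))

  swapRows-injective : ∀ {c d} → swapRows a c ≡ swapRows a d → c ≡ d
  swapRows-injective {x , y} {u , z} eq = cong₂ _,_ (swapAdjacent-injective (cong proj₁ eq)) (cong proj₂ eq)

  swapAdjacent-≤ : ∀ {u x} → ¬ (u ≡ a × x ≡ suc a) → ¬ (u ≡ suc a × x ≡ a) →
    u ≤ x ⇔ swapAdjacent a u ≤ swapAdjacent a x
  swapAdjacent-≤ {u} {x} ¬up ¬down with rowPosition a u | rowPosition a x
  ... | atUpper | atUpper = mk⇔ (λ _ → ≤-refl) (λ _ → ≤-refl)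
  ... | atUpper | atLower = contradiction (refl , refl) ¬up
  ... | atUpper | apart x≢a x≢1+a rewrite swapAdjacent-upper | swapAdjacent-apart x≢a x≢1+a =
    mk⇔ (λ a≤x → ≤∧≢⇒< a≤x (x≢a ∘ sym)) <⇒≤
  ... | atLower | atUpper = contradiction (refl , refl) ¬down
  ... | atLower | atLower = mk⇔ (λ _ → ≤-refl) (λ _ → ≤-refl)
  ... | atLower | apart x≢a x≢1+a rewrite swapAdjacent-lower | swapAdjacent-apart x≢a x≢1+a =
    mk⇔ <⇒≤ (λ a≤x → ≤∧≢⇒< a≤x (x≢a ∘ sym))
  ... | apart u≢a u≢1+a | atUpper rewrite swapAdjacent-upper | swapAdjacent-apart u≢a u≢1+a =
    mk⇔ m≤n⇒m≤1+n (λ u≤1+a → s≤s⁻¹ (≤∧≢⇒< u≤1+a u≢1+a))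
  ... | apart u≢a u≢1+a | atLower rewrite swapAdjacent-lower | swapAdjacent-apart u≢a u≢1+a =
    mk⇔ (λ u≤1+a → s≤s⁻¹ (≤∧≢⇒< u≤1+a u≢1+a)) m≤n⇒m≤1+n
  ... | apart u≢a u≢1+a | apart x≢a x≢1+a rewrite swapAdjacent-apart u≢a u≢1+a | swapAdjacent-apart x≢a x≢1+a =
    mk⇔ (λ u≤x → u≤x) (λ u≤x → u≤x)

  Straddles : Cell → Cell → Set
  Straddles (u , y) (x , z) = y ≡ z × ((u ≡ a × x ≡ suc a) ⊎ (u ≡ suc a × x ≡ a))

  InHook-swapRows : ∀ {c d} → ¬ Straddles c d → InHook (swapRows a c) (swapRows a d) ⇔ InHook c d
  InHook-swapRows {u , y} {x , z} ¬straddles = mk⇔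
    (λ { (inj₁ (x≡u , y<z)) → inj₁ (swapAdjacent-injective x≡u , y<z)
       ; (inj₂ (z≡y , u≤x)) → inj₂ (z≡y , Equivalence.from (rows-≤ z≡y) u≤x) })
    (λ { (inj₁ (x≡u , y<z)) → inj₁ (cong (swapAdjacent a) x≡u , y<z)
       ; (inj₂ (z≡y , u≤x)) → inj₂ (z≡y , Equivalence.to (rows-≤ z≡y) u≤x) })
    where
    rows-≤ : z ≡ y → u ≤ x ⇔ swapAdjacent a u ≤ swapAdjacent a x
    rows-≤ z≡y = swapAdjacent-≤ (¬straddles ∘ (sym z≡y ,_) ∘ inj₁) (¬straddles ∘ (sym z≡y ,_) ∘ inj₂)

below : Cell → Cell
below (x , y) = (suc x , y)

InHook-below : ∀ c → InHook c (below c)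
InHook-below (x , y) = inj₂ (refl , n≤1+n x)

¬InHook-above : ∀ c → ¬ InHook (below c) c
¬InHook-above (x , y) (inj₁ (x≡1+x , _)) = 1+n≢n (sym x≡1+x)
¬InHook-above (x , y) (inj₂ (_ , 1+x≤x)) = <-irrefl refl 1+x≤x

swapRows-upper : ∀ a y → swapRows a (a , y) ≡ below (swapRows a (suc a , y))
swapRows-upper a y rewrite swapAdjacent-upper a | swapAdjacent-lower a = refl

suc-∸1 : ∀ {v} → 0 < v → suc (v ∸ 1) ≡ v
suc-∸1 {suc v} _ = refl

upper-value : ∀ {t t′ v} → t ≡ suc t′ → 0 < v → t ≡ v ⇔ t′ ≡ v ∸ 1
upper-value {v = suc v} refl _ = mk⇔ suc-injective (cong suc)

module RowExchange (a : ℕ) (θ : TypeData) (uniq : Unique (shape θ)) (dom : RowDominant θ a)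
  (lab : Cell → ℕ) (lab-injective : ∀ {c d} → c ∈ shape θ → d ∈ shape θ → lab c ≡ lab d → c ≡ d) where

  S : Diagram
  S = shape θ

  Upper : Cell → Set
  Upper c = proj₁ c ≡ a

  type type′ : Cell → ℕ
  type = typeAt S lab
  type′ = movedTypeAt (swapRows a) S lab

  value : ∀ {c} → c ∈ S → Σ ℕ λ v → (c , v) ∈ θ
  value c∈ with ∈-map⁻ proj₁ c∈
  ... | (c , v) , cv∈ , refl = v , cv∈

  below-value : ∀ {c v} → (c , v) ∈ θ → Upper c → Σ ℕ λ w → (below c , w) ∈ θ × w < v
  below-value {x , y} {v} cv∈ refl = proj₂ dom y v cv∈

  below-∈ : ∀ {c} → c ∈ S → Upper c → below c ∈ S
  below-∈ c∈ upper with below-value (proj₂ (value c∈)) upper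
  ... | _ , cw∈ , _ = ∈-map⁺ proj₁ cw∈

  moved⇔smaller : ∀ {c d} → ¬ Straddles a c d →
    (InHook (swapRows a c) (swapRows a d) × lab d < lab c) ⇔ Smaller lab c d
  moved⇔smaller ¬straddles = mk⇔
    (λ (d∈H , lt) → Equivalence.to (InHook-swapRows a ¬straddles) d∈H , lt)
    (λ (d∈H , lt) → Equivalence.from (InHook-swapRows a ¬straddles) d∈H , lt)

  straddles-upper : ∀ {c d} → Upper c → Straddles a c d → d ≡ below c
  straddles-upper refl (refl , inj₁ (_ , refl)) = refl
  straddles-upper refl (_ , inj₂ (a≡1+a , _)) = contradiction (sym a≡1+a) 1+n≢n

  straddles-below : ∀ {c d} → Upper c → Straddles a (below c) d → d ≡ c
  straddles-below refl (_ , inj₁ (1+a≡a , _)) = contradiction 1+a≡a 1+n≢n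
  straddles-below refl (refl , inj₂ (_ , refl)) = refl

  ¬moved-upper-below : ∀ {c} → Upper c → ¬ InHook (swapRows a c) (swapRows a (below c))
  ¬moved-upper-below {_ , y} refl =
    subst (λ e → ¬ InHook e (swapRows a (suc a , y))) (sym (swapRows-upper a y)) (¬InHook-above _)

  moved-below-upper : ∀ {c} → Upper c → InHook (swapRows a (below c)) (swapRows a c)
  moved-below-upper {_ , y} refl =
    subst (InHook (swapRows a (suc a , y))) (sym (swapRows-upper a y)) (InHook-below _)

  type-upper : ∀ {c} → c ∈ S → Upper c → lab (below c) < lab c → type c ≡ suc (type′ c)
  type-upper c∈ upper lt = count-except S uniq (below-∈ c∈ upper)
    (λ _ d≢ → Equivalence.from (moved⇔smaller (d≢ ∘ straddles-upper upper)))
    (λ _ d≢ → Equivalence.to (moved⇔smaller (d≢ ∘ straddles-upper upper)))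
    (InHook-below _ , lt) (¬moved-upper-below upper ∘ proj₁)

  type-upper-ascending : ∀ {c} → c ∈ S → Upper c → lab c < lab (below c) → type c ≡ type′ c
  type-upper-ascending c∈ upper lt = count-cong-except S
    (λ _ d≢ → Equivalence.from (moved⇔smaller (d≢ ∘ straddles-upper upper)))
    (λ _ d≢ → Equivalence.to (moved⇔smaller (d≢ ∘ straddles-upper upper)))
    (<-asym lt ∘ proj₂) (¬moved-upper-below upper ∘ proj₁)

  type′-below : ∀ {c} → Upper c → lab (below c) < lab c → type′ (below c) ≡ type (below c)
  type′-below upper lt = count-cong-except S
    (λ _ d≢ → Equivalence.to (moved⇔smaller (d≢ ∘ straddles-below upper)))
    (λ _ d≢ → Equivalence.from (moved⇔smaller (d≢ ∘ straddles-below upper)))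
    (<-asym lt ∘ proj₂) (¬InHook-above _ ∘ proj₁)

  type′-below-ascending : ∀ {c} → c ∈ S → Upper c → lab c < lab (below c) →
    type′ (below c) ≡ suc (type (below c))
  type′-below-ascending c∈ upper lt = count-except S uniq c∈
    (λ _ d≢ → Equivalence.to (moved⇔smaller (d≢ ∘ straddles-below upper)))
    (λ _ d≢ → Equivalence.from (moved⇔smaller (d≢ ∘ straddles-below upper)))
    (moved-below-upper upper , lt) (¬InHook-above _ ∘ proj₁)

  type′-unaffected : ∀ {c} → (∀ {d} → d ∈ S → ¬ Straddles a c d) → type′ c ≡ type c
  type′-unaffected ¬straddles = count-cong S
    (λ d∈ → Equivalence.to (moved⇔smaller (¬straddles d∈)))
    (λ d∈ → Equivalence.from (moved⇔smaller (¬straddles d∈)))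

  Ordered : Set
  Ordered = ∀ {c} → c ∈ S → Upper c → lab (below c) < lab c

  type′-not-upper : Ordered → ∀ {c} → c ∈ S → ¬ Upper c → type′ c ≡ type c
  type′-not-upper ordered {x , y} c∈ ¬upper with x ≟ suc a
  ... | no x≢1+a = type′-unaffected λ _ → λ
    { (_ , inj₁ (x≡a , _)) → ¬upper x≡a
    ; (_ , inj₂ (x≡1+a , _)) → x≢1+a x≡1+a }
  ... | yes refl with any? ((a , y) ≟ᶜ_) S
  ...   | yes e∈ = type′-below {a , y} refl (ordered e∈ refl)
  ...   | no e∉ = type′-unaffected λ d∈ → λ
    { (_ , inj₁ (x≡a , _)) → ¬upper x≡a
    ; (refl , inj₂ (_ , refl)) → e∉ d∈ }

  smaller-upper : ∀ {y z} → Smaller lab (a , y) (a , z) → y < z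
  smaller-upper (inj₁ (_ , y<z) , _) = y<z
  smaller-upper (inj₂ (refl , _) , lt) = contradiction lt (<-irrefl refl)

  smaller-not-upper : ∀ {y x z} → x ≢ a → Smaller lab (a , y) (x , z) → z ≡ y × a < x
  smaller-not-upper x≢a (inj₁ (x≡a , _) , _) = contradiction x≡a x≢a
  smaller-not-upper x≢a (inj₂ (z≡y , a≤x) , _) = z≡y , ≤∧≢⇒< a≤x (x≢a ∘ sym)

  lowerIfUpper : Cell → Cell
  lowerIfUpper d with proj₁ d ≟ a
  ... | yes _ = below d
  ... | no _ = d

  -- lowerIfUpper sends the smaller arm cells of (a , y) to the cells below them and fixes its
  -- smaller leg cells, injecting the smaller hook cells of (a , y) into those of (a+1 , y).
  type-mono : ∀ {y} → (a , y) ∈ S → lab (a , y) ≤ lab (suc a , y) →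
    (∀ {e} → e ∈ S → Upper e → y < proj₂ e → lab (below e) < lab e) → type (a , y) ≤ type (suc a , y)
  type-mono {y} c∈ c≤below ordered-right = count-≤-injection S uniq lowerIfUpper injective maps
    where
    maps : ∀ {d} → d ∈ S → Smaller lab (a , y) d → lowerIfUpper d ∈ S × Smaller lab (suc a , y) (lowerIfUpper d)
    maps {x , z} d∈ smaller with x ≟ a
    ... | yes refl = below-∈ d∈ refl , inj₁ (refl , smaller-upper smaller) ,
          <-≤-trans (<-trans (ordered-right d∈ refl (smaller-upper smaller)) (proj₂ smaller)) c≤below
    ... | no x≢a = d∈ , inj₂ (smaller-not-upper x≢a smaller) , <-≤-trans (proj₂ smaller) c≤below
    injective : ∀ {d d′} → d ∈ S → d′ ∈ S → Smaller lab (a , y) d → Smaller lab (a , y) d′ →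
      lowerIfUpper d ≡ lowerIfUpper d′ → d ≡ d′
    injective {x , z} {x′ , z′} _ _ smaller smaller′ eq with x ≟ a | x′ ≟ a
    ... | yes refl | yes refl = cong (a ,_) (cong proj₂ eq)
    ... | no _ | no _ = eq
    ... | yes refl | no x′≢a =
      contradiction (trans (cong proj₂ eq) (proj₁ (smaller-not-upper x′≢a smaller′))) (<⇒≢ (smaller-upper smaller) ∘ sym)
    ... | no x≢a | yes refl =
      contradiction (trans (sym (cong proj₂ eq)) (proj₁ (smaller-not-upper x≢a smaller))) (<⇒≢ (smaller-upper smaller′) ∘ sym)

  maxColumn : ℕ
  maxColumn = max 0 (map proj₂ S)

  column≤max : ∀ {c} → c ∈ S → proj₂ c ≤ maxColumn
  column≤max c∈ = All.lookup (xs≤max 0 (map proj₂ S)) (∈-map⁺ proj₂ c∈)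

  -- Induction on the column from the right: at an ascent, all columns further right descend,
  -- which is what type-mono needs.
  ordered-if-no-ascent : (∀ {c} → c ∈ S → Upper c → lab c < lab (below c) → ¬ type c ≤ type (below c)) → Ordered
  ordered-if-no-ascent no-ascent {c} = wfRec (λ c → c ∈ S → Upper c → lab (below c) < lab c) from-the-right c
    where
    open WF.All (On.wellFounded (λ c → maxColumn ∸ proj₂ c) <-wellFounded) 0ℓ
    from-the-right : ∀ c →
      (∀ {e} → maxColumn ∸ proj₂ e < maxColumn ∸ proj₂ c → e ∈ S → Upper e → lab (below e) < lab e) →
      c ∈ S → Upper c → lab (below c) < lab c
    from-the-right (x , y) ordered-right c∈ refl with lab (below (a , y)) <? lab (a , y)
    ... | yes descent = descent
    ... | no ¬descent = contradiction
      (type-mono c∈ (<⇒≤ ascent) λ e∈ e-upper y<e → ordered-right (∸-monoʳ-< y<e (column≤max e∈)) e∈ e-upper)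
      (no-ascent c∈ refl ascent)
      where
      ascent : lab (a , y) < lab (suc a , y)
      ascent = ≤∧≢⇒< (≮⇒≥ ¬descent) (1+n≢n ∘ sym ∘ cong proj₁ ∘ lab-injective c∈ (below-∈ c∈ refl))

  type⇔type′-not-upper : Ordered → ∀ {c v} → c ∈ S → ¬ Upper c → type c ≡ v ⇔ type′ c ≡ v
  type⇔type′-not-upper ordered c∈ ¬upper =
    mk⇔ (trans (type′-not-upper ordered c∈ ¬upper)) (trans (sym (type′-not-upper ordered c∈ ¬upper)))

  type⇔type′ : Ordered → ∀ {c v} → (c , v) ∈ θ → type c ≡ v ⇔ type′ c ≡ proj₂ (moveRowDown a (c , v))
  type⇔type′ ordered {x , y} {v} cv∈ with rowPosition a x
  ... | atUpper rewrite moveRowDown-upper a y v =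
    upper-value (type-upper c∈ refl (ordered c∈ refl)) (≤-trans (s≤s z≤n) (proj₂ (proj₂ (below-value cv∈ refl))))
    where
    c∈ : (a , y) ∈ S
    c∈ = ∈-map⁺ proj₁ cv∈
  ... | atLower rewrite moveRowDown-lower a y v = type⇔type′-not-upper ordered (∈-map⁺ proj₁ cv∈) 1+n≢n
  ... | apart x≢a x≢1+a rewrite moveRowDown-apart a y v x≢a x≢1+a =
    type⇔type′-not-upper ordered (∈-map⁺ proj₁ cv∈) x≢a

  Typed Typed′ : Set
  Typed = All (λ cv → type (proj₁ cv) ≡ proj₂ cv) θ
  Typed′ = All (λ cv → type′ (proj₁ cv) ≡ proj₂ (moveRowDown a cv)) θ

  typed-ordered : Typed → Ordered
  typed-ordered typed = ordered-if-no-ascent λ c∈ upper _ mono →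
    let v , cv∈ = value c∈ ; w , cw∈ , w<v = below-value cv∈ upper in
    <⇒≱ w<v (subst₂ _≤_ (All.lookup typed cv∈) (All.lookup typed cw∈) mono)

  typed′-ordered : Typed′ → Ordered
  typed′-ordered typed′ = ordered-if-no-ascent λ { {_ , y} c∈ refl ascent mono →
    let v , cv∈ = value c∈ ; w , cw∈ , w<v = below-value cv∈ refl
        type-upper≡ : type (a , y) ≡ v ∸ 1
        type-upper≡ = trans (type-upper-ascending c∈ refl ascent)
                            (trans (All.lookup typed′ cv∈) (cong proj₂ (moveRowDown-upper a y v)))
        type-below≡ : suc (type (suc a , y)) ≡ w
        type-below≡ = trans (sym (type′-below-ascending c∈ refl ascent))
                            (trans (All.lookup typed′ cw∈) (cong proj₂ (moveRowDown-lower a y w)))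
    in <⇒≱ w<v (subst₂ _≤_ (trans (cong suc type-upper≡) (suc-∸1 (≤-trans (s≤s z≤n) w<v))) type-below≡ (s≤s mono)) }

  typed⇔typed′ : Typed ⇔ Typed′
  typed⇔typed′ = mk⇔
    (λ typed → All.tabulate λ cv∈ →
      Equivalence.to (type⇔type′ (typed-ordered typed) cv∈) (All.lookup typed cv∈))
    (λ typed′ → All.tabulate λ cv∈ →
      Equivalence.from (type⇔type′ (typed′-ordered typed′) cv∈) (All.lookup typed′ cv∈))

numTab-rowDown : ∀ a θ → Unique (shape θ) → RowDominant θ a → numTab θ ≡ numTab (rowDown a θ)
numTab-rowDown a θ uniq dom = numTab-map λ p∈ →
  RowExchange.typed⇔typed′ a θ uniq dom _ (perms-labelling-injective uniq p∈)
  where open Relocation θ (moveRowDown a) (swapRows a) (moveRowDown-cell a) (λ _ _ → swapRows-injective a)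

Unique-rowDown : ∀ a θ → Unique (shape θ) → Unique (shape (rowDown a θ))
Unique-rowDown a θ =
  Relocation.Unique-shape-map θ (moveRowDown a) (swapRows a) (moveRowDown-cell a) (λ _ _ → swapRows-injective a)

-- Deleting empty rows

rank : List ℕ → ℕ → ℕ
rank R x = length (filterᵇ (_<ᵇ x) R)

module _ (R : List ℕ) where

  rank≡count : ∀ x → rank R x ≡ count (_<? x) R
  rank≡count x = cong length (sym (filter≡filterᵇ (_<? x) (_<ᵇ x) (λ _ → refl) R))

  rank-mono : ∀ {u x} → u ≤ x → rank R u ≤ rank R x
  rank-mono {u} {x} u≤x = subst₂ _≤_ (sym (rank≡count u)) (sym (rank≡count x))
    (count-mono R λ _ d<u → <-≤-trans d<u u≤x)

  rank-< : ∀ {u x} → u ∈ R → u < x → rank R u < rank R x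
  rank-< {u} {x} u∈ u<x = subst₂ _<_ (sym (rank≡count u)) (sym (rank≡count x))
    (count-< R (λ _ d<u → <-trans d<u u<x) u∈ (<-irrefl refl) u<x)

  rank-≤⇔ : ∀ {u x} → x ∈ R → u ≤ x ⇔ rank R u ≤ rank R x
  rank-≤⇔ {u} {x} x∈ = mk⇔ rank-mono λ ranks≤ → ≮⇒≥ λ x<u → <⇒≱ (rank-< x∈ x<u) ranks≤

  rank-injective : ∀ {u x} → u ∈ R → x ∈ R → rank R u ≡ rank R x → u ≡ x
  rank-injective u∈ x∈ eq = ≤-antisym
    (Equivalence.from (rank-≤⇔ x∈) (≤-reflexive eq)) (Equivalence.from (rank-≤⇔ u∈) (≤-reflexive (sym eq)))

-- renumberRows θ is definitionally map (renumberRow θ) θ.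
renumberRow : TypeData → Cell × ℕ → Cell × ℕ
renumberRow θ ((a , b) , v) = ((suc (rank (occRows θ) a) , b) , v)

renumberCell : TypeData → Cell → Cell
renumberCell θ (a , b) = (suc (rank (occRows θ) a) , b)

module _ (θ : TypeData) where

  private
    R : List ℕ
    R = occRows θ

  row∈occRows : ∀ {c} → c ∈ shape θ → proj₁ c ∈ R
  row∈occRows c∈ = ∈-deduplicate⁺ _≟_ (∈-map⁺ proj₁ c∈)

  renumberCell-injective : ∀ {c d} → c ∈ shape θ → d ∈ shape θ → renumberCell θ c ≡ renumberCell θ d → c ≡ d
  renumberCell-injective c∈ d∈ eq =
    cong₂ _,_ (rank-injective R (row∈occRows c∈) (row∈occRows d∈) (suc-injective (cong proj₁ eq))) (cong proj₂ eq)

  InHook-renumberCell : ∀ {c d} → c ∈ shape θ → d ∈ shape θ →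
    InHook (renumberCell θ c) (renumberCell θ d) ⇔ InHook c d
  InHook-renumberCell c∈ d∈ = mk⇔
    (λ { (inj₁ (eq , lt)) → inj₁ (rank-injective R (row∈occRows d∈) (row∈occRows c∈) (suc-injective eq) , lt)
       ; (inj₂ (eq , le)) → inj₂ (eq , Equivalence.from (rank-≤⇔ R (row∈occRows d∈)) (s≤s⁻¹ le)) })
    (λ { (inj₁ (refl , lt)) → inj₁ (refl , lt)
       ; (inj₂ (eq , le)) → inj₂ (eq , s≤s (Equivalence.to (rank-≤⇔ R (row∈occRows d∈)) le)) })

  numTab-renumberRows : numTab θ ≡ numTab (renumberRows θ)
  numTab-renumberRows = numTab-map-preservingHooks InHook-renumberCell λ _ → refl
    where open Relocation θ (renumberRow θ) (renumberCell θ) (λ _ → refl) renumberCell-injective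

  Unique-renumberRows : Unique (shape θ) → Unique (shape (renumberRows θ))
  Unique-renumberRows = Relocation.Unique-shape-map θ (renumberRow θ) (renumberCell θ) (λ _ → refl) renumberCell-injective

numTab-lineRun : ∀ {θ θL} → Unique (shape θ) → LineRun θ θL → numTab θ ≡ numTab θL
numTab-lineRun uniq (stop _) = refl
numTab-lineRun {θ} uniq (step i dom _ run) =
  trans (numTab-rowDown i θ uniq dom) (numTab-lineRun (Unique-rowDown i θ uniq) run)

numTab-lineExchange : ∀ {θ θL} → Unique (shape θ) → LineExchange θ θL → numTab θ ≡ numTab θL
numTab-lineExchange {θ} uniq run = trans (numTab-renumberRows θ) (numTab-lineRun (Unique-renumberRows θ uniq) run)

rowDominant? : ∀ θ → Decidable (RowDominant θ)
rowDominant? θ a = map′ fromAny toAny (any? (λ e → proj₁ (proj₁ e) ≟ a) θ)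
              ×-dec map′ fromAll toAll (all? (λ e → (proj₁ (proj₁ e) ≟ a) →-dec any? (dominated? e) θ) θ)
  where
  Dominated : Cell × ℕ → Cell × ℕ → Set
  Dominated ((_ , y) , v) (d , w) = d ≡ (suc a , y) × w < v
  dominated? : ∀ e → Decidable (Dominated e)
  dominated? ((_ , y) , v) (d , w) = (d ≟ᶜ (suc a , y)) ×-dec (w <? v)
  fromAny : Any (λ e → proj₁ (proj₁ e) ≡ a) θ → Σ ℕ λ y → Σ ℕ λ v → ((a , y) , v) ∈ θ
  fromAny any with find any
  ... | ((_ , y) , v) , e∈ , refl = y , v , e∈
  toAny : (Σ ℕ λ y → Σ ℕ λ v → ((a , y) , v) ∈ θ) → Any (λ e → proj₁ (proj₁ e) ≡ a) θ
  toAny (_ , _ , e∈) = lose e∈ refl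
  fromAll : All (λ e → proj₁ (proj₁ e) ≡ a → Any (Dominated e) θ) θ →
    ∀ y v → ((a , y) , v) ∈ θ → Σ ℕ λ w → ((suc a , y) , w) ∈ θ × w < v
  fromAll all y v e∈ with find (All.lookup all e∈ refl)
  ... | (_ , w) , d∈ , refl , w<v = w , d∈ , w<v
  toAll : (∀ y v → ((a , y) , v) ∈ θ → Σ ℕ λ w → ((suc a , y) , w) ∈ θ × w < v) →
    All (λ e → proj₁ (proj₁ e) ≡ a → Any (Dominated e) θ) θ
  toAll dominated = All.tabulate λ { {(_ , y) , v} e∈ refl →
    let w , d∈ , w<v = dominated y v e∈ in lose d∈ (refl , w<v) }

leastBelow : {P : ℕ → Set} → (∀ n → Dec (P n)) → ∀ n →
  (Σ ℕ λ i → P i × (∀ j → j < i → ¬ P j)) ⊎ (∀ j → j < n → ¬ P j)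
leastBelow P? zero = inj₂ λ _ ()
leastBelow P? (suc n) with leastBelow P? n
... | inj₁ least = inj₁ least
... | inj₂ none with P? n
...   | yes pn = inj₁ (n , pn , none)
...   | no ¬pn = inj₂ λ j j<1+n → [ none j , (λ { refl → ¬pn }) ]′ (m≤n⇒m<n∨m≡n (s≤s⁻¹ j<1+n))

maxRow : TypeData → ℕ
maxRow θ = max 0 (map (proj₁ ∘ proj₁) θ)

dominantRow≤maxRow : ∀ {θ i} → RowDominant θ i → i ≤ maxRow θ
dominantRow≤maxRow ((_ , _ , e∈) , _) = All.lookup (xs≤max 0 _) (∈-map⁺ (proj₁ ∘ proj₁) e∈)

firstDominantRow : ∀ θ →
  (Σ ℕ λ i → RowDominant θ i × (∀ j → j < i → ¬ RowDominant θ j)) ⊎ (∀ i → ¬ RowDominant θ i)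
firstDominantRow θ with leastBelow (rowDominant? θ) (suc (maxRow θ))
... | inj₁ least = inj₁ least
... | inj₂ none = inj₂ λ i dom → none i (s≤s (dominantRow≤maxRow dom)) dom

valueSum : TypeData → ℕ
valueSum θ = sum (map proj₂ θ)

sum-map-< : {A : Set} (f g : A → ℕ) → ∀ {xs} → (∀ {x} → x ∈ xs → f x ≤ g x) →
  ∀ {x₀} → x₀ ∈ xs → f x₀ < g x₀ → sum (map f xs) < sum (map g xs)
sum-map-< f g f≤g (here refl) fx<gx = +-mono-<-≤ fx<gx (sum-map-≤ λ x∈ → f≤g (there x∈))
  where
  sum-map-≤ : ∀ {xs} → (∀ {x} → x ∈ xs → f x ≤ g x) → sum (map f xs) ≤ sum (map g xs)
  sum-map-≤ {[]} _ = z≤n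
  sum-map-≤ {x ∷ xs} f≤g = +-mono-≤ (f≤g (here refl)) (sum-map-≤ λ x∈ → f≤g (there x∈))
sum-map-< f g f≤g (there x₀∈) fx<gx =
  +-mono-≤-< (f≤g (here refl)) (sum-map-< f g (λ x∈ → f≤g (there x∈)) x₀∈ fx<gx)

moveRowDown-value-≤ : ∀ a e → proj₂ (moveRowDown a e) ≤ proj₂ e
moveRowDown-value-≤ a ((x , y) , v) with rowPosition a x
... | atUpper rewrite moveRowDown-upper a y v = m∸n≤m v 1
... | atLower rewrite moveRowDown-lower a y v = ≤-refl
... | apart x≢a x≢1+a rewrite moveRowDown-apart a y v x≢a x≢1+a = ≤-refl

valueSum-rowDown : ∀ {θ a} → RowDominant θ a → valueSum (rowDown a θ) < valueSum θ
valueSum-rowDown {θ} {a} ((y , v , e∈) , dominated) = begin-strict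
  valueSum (rowDown a θ)                 ≡⟨ cong sum (map-∘ θ) ⟨
  sum (map (proj₂ ∘ moveRowDown a) θ)   <⟨ sum-map-< _ proj₂ (λ {e} _ → moveRowDown-value-≤ a e) e∈ decreases ⟩
  valueSum θ                             ∎
  where
  open ≤-Reasoning
  decreases : proj₂ (moveRowDown a ((a , y) , v)) < v
  decreases rewrite moveRowDown-upper a y v with dominated y v e∈
  ... | w , _ , w<v = ∸-monoʳ-< {o = 0} (s≤s z≤n) (≤-trans (s≤s z≤n) w<v)

lineRun-exists : ∀ θ → Σ TypeData (LineRun θ)
lineRun-exists = wfRec (λ θ → Σ TypeData (LineRun θ)) run
  where
  open WF.All (On.wellFounded valueSum <-wellFounded) 0ℓ
  run : ∀ θ → (∀ {θ′} → valueSum θ′ < valueSum θ → Σ TypeData (LineRun θ′)) → Σ TypeData (LineRun θ)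
  run θ rec with firstDominantRow θ
  ... | inj₂ none = θ , stop none
  ... | inj₁ (i , dom , earlier) =
    let θL , rest = rec {rowDown i θ} (valueSum-rowDown dom) in θL , step i dom earlier rest

lineExchange-exists : ∀ θ → Σ TypeData (LineExchange θ)
lineExchange-exists θ = lineRun-exists (renumberRows θ)

-- Transposition

transpose : TypeData → TypeData
transpose = map (map₁ swap)

transpose-involutive : ∀ θ → transpose (transpose θ) ≡ θ
transpose-involutive [] = refl
transpose-involutive (e ∷ θ) = cong (e ∷_) (transpose-involutive θ)

∈-transpose⁻ : ∀ {θ e} → e ∈ transpose θ → map₁ swap e ∈ θ
∈-transpose⁻ e∈ with ∈-map⁻ (map₁ swap) e∈
... | _ , e′∈ , refl = e′∈

-- The arm and the leg of a hook differ only in which of them contains the corner cell.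
InHook-transpose : ∀ c d → InHook (swap c) (swap d) → InHook c d
InHook-transpose (a , b) (x , y) (inj₁ (y≡b , a<x)) = inj₂ (y≡b , <⇒≤ a<x)
InHook-transpose (a , b) (x , y) (inj₂ (x≡a , b≤y)) with y ≟ b
... | yes y≡b = inj₂ (y≡b , ≤-reflexive (sym x≡a))
... | no y≢b = inj₁ (x≡a , ≤∧≢⇒< b≤y (y≢b ∘ sym))

numTab-transpose : ∀ θ → numTab θ ≡ numTab (transpose θ)
numTab-transpose θ = numTab-map-preservingHooks
  (λ {c} {d} _ _ → mk⇔ (InHook-transpose c d) (InHook-transpose (swap c) (swap d))) λ _ → refl
  where open Relocation θ (map₁ swap) swap (λ _ → refl) (λ _ _ → cong swap)

Unique-transpose : ∀ {θ} → Unique (shape θ) → Unique (shape (transpose θ))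
Unique-transpose {θ} = Relocation.Unique-shape-map θ (map₁ swap) swap (λ _ → refl) (λ _ _ → cong swap)

colDominant⇒rowDominant : ∀ {θ b} → ColDominant θ b → RowDominant (transpose θ) b
colDominant⇒rowDominant ((x , v , e∈) , dominated) =
  (x , v , ∈-map⁺ (map₁ swap) e∈) ,
  λ y v e∈ → let w , d∈ , w<v = dominated y v (∈-transpose⁻ e∈) in w , ∈-map⁺ (map₁ swap) d∈ , w<v

rowDominant⇒colDominant : ∀ {θ b} → RowDominant (transpose θ) b → ColDominant θ b
rowDominant⇒colDominant ((y , v , e∈) , dominated) =
  (y , v , ∈-transpose⁻ e∈) ,
  λ x v e∈ → let w , d∈ , w<v = dominated x v (∈-map⁺ (map₁ swap) e∈) in w , ∈-transpose⁻ d∈ , w<v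

transpose-colRight : ∀ b θ → transpose (colRight b θ) ≡ rowDown b (transpose θ)
transpose-colRight b [] = refl
transpose-colRight b (((x , y) , v) ∷ θ) with y ≡ᵇ b
... | true = cong (_ ∷_) (transpose-colRight b θ)
... | false with y ≡ᵇ suc b
...   | true = cong (_ ∷_) (transpose-colRight b θ)
...   | false = cong (_ ∷_) (transpose-colRight b θ)

occCols≡occRows-transpose : ∀ θ → occCols θ ≡ occRows (transpose θ)
occCols≡occRows-transpose θ = cong (deduplicate _≟_) (columns θ)
  where
  columns : ∀ θ → map proj₂ (shape θ) ≡ map proj₁ (shape (transpose θ))
  columns [] = refl
  columns (e ∷ θ) = cong (_ ∷_) (columns θ)

transpose-renumberCols : ∀ θ → transpose (renumberCols θ) ≡ renumberRows (transpose θ)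
transpose-renumberCols θ = trans (sym (map-∘ θ)) (trans (map-cong renumbered θ) (map-∘ θ))
  where
  renumbered : ∀ e → map₁ swap ((proj₁ (proj₁ e) , suc (rank (occCols θ) (proj₂ (proj₁ e)))) , proj₂ e)
                   ≡ renumberRow (transpose θ) (map₁ swap e)
  renumbered ((x , y) , v) = cong (λ R → ((suc (rank R y) , x) , v)) (occCols≡occRows-transpose θ)

colRun⇒lineRun : ∀ {θ θC} → ColRun θ θC → LineRun (transpose θ) (transpose θC)
colRun⇒lineRun (stop none) = stop λ i dom → none i (rowDominant⇒colDominant dom)
colRun⇒lineRun {θ} (step i dom earlier run) =
  step i (colDominant⇒rowDominant dom) (λ j j<i → earlier j j<i ∘ rowDominant⇒colDominant)
    (subst (λ θ′ → LineRun θ′ _) (transpose-colRight i θ) (colRun⇒lineRun run))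

lineRun⇒colRun : ∀ {θ θ′ θL} → θ′ ≡ transpose θ → LineRun θ′ θL → ColRun θ (transpose θL)
lineRun⇒colRun {θ} refl (stop none) =
  subst (ColRun θ) (sym (transpose-involutive θ)) (stop λ i → none i ∘ colDominant⇒rowDominant)
lineRun⇒colRun {θ} refl (step i dom earlier run) =
  step i (rowDominant⇒colDominant dom) (λ j j<i → earlier j j<i ∘ colDominant⇒rowDominant)
    (lineRun⇒colRun (sym (transpose-colRight i θ)) run)

columnExchange⇒lineExchange : ∀ {θ θC} → ColumnExchange θ θC → LineExchange (transpose θ) (transpose θC)
columnExchange⇒lineExchange {θ} run = subst (λ θ′ → LineRun θ′ _) (transpose-renumberCols θ) (colRun⇒lineRun run)

lineExchange⇒columnExchange : ∀ {θ θL} → LineExchange (transpose θ) θL → ColumnExchange θ (transpose θL)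
lineExchange⇒columnExchange {θ} = lineRun⇒colRun (sym (transpose-renumberCols θ))

columnExchange-exists : ∀ θ → Σ TypeData (ColumnExchange θ)
columnExchange-exists θ = let θL , run = lineExchange-exists (transpose θ) in transpose θL , lineExchange⇒columnExchange run

numTab-columnExchange : ∀ {θ θC} → Unique (shape θ) → ColumnExchange θ θC → numTab θ ≡ numTab θC
numTab-columnExchange {θ} {θC} uniq run = begin
  numTab θ               ≡⟨ numTab-transpose θ ⟩
  numTab (transpose θ)   ≡⟨ numTab-lineExchange (Unique-transpose uniq) (columnExchange⇒lineExchange run) ⟩
  numTab (transpose θC)  ≡⟨ numTab-transpose θC ⟨
  numTab θC              ∎
  where open ≡-Reasoning

mainTheorem10 : (θ : TypeData) → IsType θ →
    ((Σ TypeData λ θL → LineExchange θ θL)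
      × (∀ θL → LineExchange θ θL → numTab θ ≡ numTab θL))
    × ((Σ TypeData λ θC → ColumnExchange θ θC)
      × (∀ θC → ColumnExchange θ θC → numTab θ ≡ numTab θC))
mainTheorem10 θ (uniq , _) =
  (lineExchange-exists θ , λ _ → numTab-lineExchange uniq) ,
  (columnExchange-exists θ , λ _ → numTab-columnExchange uniq)
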